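{- In constructive mathematics, consider the statement: "For any partially ordered set $(X,\sim)$, with $x<y$ defined as $x\sim y$ and $\neg(x=y)$: if for all $x,y\in X$, $\neg(y<x)$ implies $x\sim y$, then $\sim$ is total and equality on $X$ is decidable." This statement implies the weak law of excluded middle: for every proposition $P$, either $\neg P$ or $\neg\neg P$.
   Context: The setting is constructive mathematics: no use of the law of excluded middle. A partially ordered set is a set $X$ with a binary relation $\sim$ (respecting equality) that is reflexive ($x\sim x$), transitive ($x\sim y$ and $y\sim z$ imply $x\sim z$) and antisymmetric ($x\sim y$ and $y\sim x$ imply $x=y$). The relation $\sim$ is total if for all $x,y$, $x\sim y$ or $y\sim x$. Equality is decidable if for all $x,y$, $x=y$ or $\neg(x=y)$. -}

module Defs where

open import Level using (Level; _⊔_; suc)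
open import Data.Product using (_×_)
open import Data.Sum using (_⊎_)
open import Relation.Nullary using (¬_)
open import Relation.Binary.Bundles using (Poset)
open import Relation.Binary.Definitions using (Total; Decidable)

-- x < y  :=  x ∼ y and ¬ (x = y)   (equality is the poset's setoid equality)
module _ {c ℓ₁ ℓ₂ : Level} (X : Poset c ℓ₁ ℓ₂) where
  open Poset X

  Strict : Carrier → Carrier → Set (ℓ₁ ⊔ ℓ₂)
  Strict x y = (x ≤ y) × ¬ (x ≈ y)

  NotGreaterImpliesLeq : Set (c ⊔ ℓ₁ ⊔ ℓ₂)
  NotGreaterImpliesLeq = ∀ x y → ¬ Strict y x → x ≤ y

  TotalAndDecEq : Set (c ⊔ ℓ₁ ⊔ ℓ₂)
  TotalAndDecEq = Total _≤_ × (∀ x y → x ≈ y ⊎ ¬ (x ≈ y))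

PosetStatement : (c ℓ₁ ℓ₂ : Level) → Set (suc (c ⊔ ℓ₁ ⊔ ℓ₂))
PosetStatement c ℓ₁ ℓ₂ =
  (X : Poset c ℓ₁ ℓ₂) → NotGreaterImpliesLeq X → TotalAndDecEq X

WLEM : (ℓ : Level) → Set (suc ℓ)
WLEM ℓ = (P : Set ℓ) → ¬ P ⊎ ¬ ¬ P

module Submission where

open import Level using (0ℓ)
open import Defs
open import Data.Bool using (Bool; true; false)
open import Data.Unit using (⊤; tt)
open import Data.Product using (_×_; _,_; proj₁)
open import Data.Sum using (_⊎_; inj₁; inj₂)
open import Relation.Nullary using (¬_)
open import Relation.Nullary.Negation using (Stable; negated-stable)
open import Relation.Binary.Bundles using (Poset)

-- For a proposition Q, order the two points false, true by
-- false ≤ true always and true ≤ false iff Q, so that they become equal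
-- exactly when Q holds. If Q is ¬¬-stable this poset satisfies the
-- hypothesis, and deciding whether true equals false decides Q. Taking
-- Q = ¬ P, which is always ¬¬-stable, gives ¬ P ⊎ ¬ ¬ P.

module TwoPointCollapse (Q : Set) where

  _≤_ : Bool → Bool → Set
  true ≤ false = Q
  _    ≤ _     = ⊤

  _≈_ : Bool → Bool → Set
  x ≈ y = x ≤ y × y ≤ x

  ≤-refl : ∀ {x} → x ≤ x
  ≤-refl {true}  = tt
  ≤-refl {false} = tt

  ≤-trans : ∀ {x y z} → x ≤ y → y ≤ z → x ≤ z
  ≤-trans {false} {_}     {true}  _ _ = tt
  ≤-trans {false} {_}     {false} _ _ = tt
  ≤-trans {true}  {_}     {true}  _ _ = tt
  ≤-trans {true}  {true}  {false} _ q = q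
  ≤-trans {true}  {false} {false} q _ = q

  poset : Poset 0ℓ 0ℓ 0ℓ
  poset = record
    { Carrier        = Bool
    ; _≈_            = _≈_
    ; _≤_            = _≤_
    ; isPartialOrder = record
      { isPreorder = record
        { isEquivalence = record
          { refl  = ≤-refl , ≤-refl
          ; sym   = λ (x≤y , y≤x) → y≤x , x≤y
          ; trans = λ (x≤y , y≤x) (y≤z , z≤y) → ≤-trans x≤y y≤z , ≤-trans z≤y y≤x
          }
        ; reflexive = proj₁
        ; trans     = ≤-trans
        }
      ; antisym = _,_
      }
    }

  notGreaterImpliesLeq : Stable Q → NotGreaterImpliesLeq poset
  notGreaterImpliesLeq stable true  false ¬false<true =
    stable λ ¬q → ¬false<true (tt , λ (_ , q) → ¬q q)
  notGreaterImpliesLeq _      true  true  _ = tt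
  notGreaterImpliesLeq _      false _     _ = tt

  decide : TotalAndDecEq poset → Q ⊎ ¬ Q
  decide (_ , _≟_) with true ≟ false
  ... | inj₁ (q , _) = inj₁ q
  ... | inj₂ true≉false = inj₂ λ q → true≉false (q , tt)

posetStatement⇒stable-decidable : PosetStatement 0ℓ 0ℓ 0ℓ →
                                  (Q : Set) → Stable Q → Q ⊎ ¬ Q
posetStatement⇒stable-decidable statement Q stable =
  decide (statement poset (notGreaterImpliesLeq stable))
  where open TwoPointCollapse Q

theorem16 : PosetStatement 0ℓ 0ℓ 0ℓ → WLEM 0ℓ
theorem16 statement P =
  posetStatement⇒stable-decidable statement (¬ P) negated-stable
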